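{- Let $s\in\mathbb{N}$ and $a\in\mathbb{Z}$, let $G$ be a graph and $S\subseteq V(G)$ with $|S|=s$. If $b\geq\max\{s+2a+16,\ s+6\}$ and $\mathcal{E}(G;S,q)=aq^2-bq+c$, then for all $1\leq k\leq s$, $$\sum_{W\in\binom{S}{k}}|\mathrm{Obs}(G;W)|=\binom{s-2}{k-2}\sum_{W\in\binom{S}{2}}|\mathrm{Obs}(G;W)|+\left(\binom{s-1}{k-1}-(s-1)\binom{s-2}{k-2}\right)\sum_{v\in S}|\mathrm{Obs}(G;\{v\})|.$$
   Context: Graphs are finite and simple; $N[X]$ is the closed neighborhood of $X$. Power domination process on a graph $H$ from $T\subseteq V(H)$: set $B:=N[T]$; then, while some $x\in B$ has exactly one vertex $y$ of $N[x]$ outside $B$, add $y$ to $B$. The final set is $\mathrm{Obs}(H;T)$ (with $\mathrm{Obs}(H;\emptyset)=\emptyset$). For $S\subseteq V(H)$, $\mathcal{E}(H;S,q)=\sum_{W\subseteq S}|\mathrm{Obs}(H;W)|\,q^{|S\setminus W|}(1-q)^{|W|}$, a polynomial in $q$. $\binom{S}{k}$ is the set of $k$-element subsets of $S$; binomial coefficients with negative lower index are $0$. -}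

module Defs where

open import Data.Nat as ℕ using (ℕ; zero; suc)
open import Data.Nat.Combinatorics using (_C_)
open import Data.Integer as ℤ using (ℤ; +_; -[1+_])
open import Data.Bool using (Bool; true; false; _∧_; _∨_; not; if_then_else_)
open import Data.Fin using (Fin; _≟_)
open import Data.Fin.Subset using (Subset; ⊥; ⁅_⁆; ∣_∣; _─_)
open import Data.Vec using (Vec; []; _∷_; lookup; tabulate; _[_]≔_)
open import Data.List using (List; []; _∷_; map; filter; length; _++_; allFin)
open import Data.Nat.ListAction using (sum)
open import Data.Maybe using (Maybe; just; nothing)
open import Relation.Nullary.Decidable using (⌊_⌋)
open import Relation.Binary.PropositionalEquality using (_≡_)

record Graph : Set where
  field
    n       : ℕ
    adj     : Fin n → Fin n → Bool
    sym     : ∀ x y → adj x y ≡ adj y x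
    irrefl  : ∀ x → adj x x ≡ false
open Graph public

mem : ∀ {m} → Fin m → Subset m → Bool
mem x B = lookup B x

inN : (H : Graph) → Fin (n H) → Fin (n H) → Bool
inN H x y = ⌊ y ≟ x ⌋ ∨ adj H x y

closedN : (H : Graph) → Subset (n H) → Subset (n H)
closedN H T = tabulate λ y → anyL (allFin (n H)) y
  where
  anyL : List (Fin (n H)) → Fin (n H) → Bool
  anyL [] y = false
  anyL (x ∷ xs) y = (mem x T ∧ inN H x y) ∨ anyL xs y

outside : (H : Graph) → Subset (n H) → Fin (n H) → List (Fin (n H))
outside H B x = filter (λ y → Data.Bool._≟_ (inN H x y ∧ not (mem y B)) true) (allFin (n H))
  where import Data.Bool

forced : (H : Graph) → Subset (n H) → Maybe (Fin (n H))
forced H B = go (allFin (n H))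
  where
  go : List (Fin (n H)) → Maybe (Fin (n H))
  go [] = nothing
  go (x ∷ xs) with mem x B | outside H B x
  ... | true | y ∷ [] = just y
  ... | _    | _      = go xs

-- run the propagation rule with fuel (each productive step adds a new vertex,
-- so fuel n H suffices to reach the final set)
propagate : (H : Graph) → ℕ → Subset (n H) → Subset (n H)
propagate H zero B = B
propagate H (suc f) B with forced H B
... | nothing = B
... | just y  = propagate H f (B [ y ]≔ true)

-- Obs(H;T)  (note Obs(H;∅) = ∅ automatically, since N[∅] = ∅)
Obs : (H : Graph) → Subset (n H) → Subset (n H)
Obs H T = propagate H (n H) (closedN H T)

allSubsets : (m : ℕ) → List (Subset m)
allSubsets zero = [] ∷ []
allSubsets (suc m) = map (false ∷_) (allSubsets m) ++ map (true ∷_) (allSubsets m)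

subsetB : ∀ {m} → Subset m → Subset m → Bool
subsetB [] [] = true
subsetB (w ∷ ws) (s ∷ ss) = (not w ∨ s) ∧ subsetB ws ss

subsetsOf : ∀ {m} → Subset m → List (Subset m)
subsetsOf {m} S = filter (λ W → Data.Bool._≟_ (subsetB W S) true) (allSubsets m)
  where import Data.Bool

subsetsOfSize : ∀ {m} → Subset m → ℕ → List (Subset m)
subsetsOfSize S k = filter (λ W → ∣ W ∣ ℕ.≟ k) (subsetsOf S)

sumℤ : List ℤ → ℤ
sumℤ [] = + 0
sumℤ (x ∷ xs) = x ℤ.+ sumℤ xs

powℤ : ℤ → ℕ → ℤ
powℤ q zero = + 1
powℤ q (suc e) = q ℤ.* powℤ q e

calE : (H : Graph) → Subset (n H) → ℤ → ℤ
calE H S q = sumℤ (map term (subsetsOf S))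
  where
  term : Subset (n H) → ℤ
  term W = + ∣ Obs H W ∣ ℤ.* (powℤ q ∣ S ─ W ∣ ℤ.* powℤ (+ 1 ℤ.- q) ∣ W ∣)

sumObsK : (H : Graph) → Subset (n H) → ℕ → ℕ
sumObsK H S k = sum (map (λ W → ∣ Obs H W ∣) (subsetsOfSize S k))

sumObs1 : (H : Graph) → Subset (n H) → ℕ
sumObs1 H S = sum (map (λ v → if mem v S then ∣ Obs H ⁅ v ⁆ ∣ else 0) (allFin (n H)))

-- binomial coefficient with integer arguments; 0 when the lower index is negative.
-- (A negative upper index with nonnegative lower index never occurs in the theorem.)
binomℤ : ℤ → ℤ → ℤ
binomℤ _ -[1+ _ ] = + 0
binomℤ (+ a) (+ b) = + (a C b)
binomℤ -[1+ _ ] (+ _) = + 0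

{-# OPTIONS --safe #-}
-- Grouping the subsets W ⊆ S by size gives 𝓔(G;S,q) = Σ_{k ≤ s} f k · q^(s-k) (1-q)^k with
-- f k = Σ_{W ∈ (S choose k)} |Obs(G;W)|: f is the coefficient vector of 𝓔 in the Bernstein basis
-- of degree s.  That basis is linearly independent over ℤ, and
-- (1-q)^j = Σ_k C(s-j, k-j) q^(s-k) (1-q)^k, so writing the quadratic 𝓔 as α + β(1-q) + γ(1-q)²
-- yields f k = α C(s,k) + β C(s-1,k-1) + γ C(s-2,k-2).  As Obs(G;∅) = ∅, α = f 0 = 0; then
-- f 1 = β and f 2 = (s-1)β + γ, which is the claimed identity.
module Submission where

open import Defs
open import Data.Nat using (ℕ; _≤_)
open import Data.Integer as ℤ using (ℤ; +_)
open import Data.Fin.Subset using (Subset; ∣_∣)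
open import Relation.Binary.PropositionalEquality using (_≡_)

open import Data.Bool as Bool using (Bool; true; false; _∧_; if_then_else_)
import Data.Bool.Properties as BoolP
open import Data.Fin using (Fin; zero)
open import Data.Fin.Subset using (_─_; ⊥; ⁅_⁆)
import Data.Fin.Subset.Properties as SubP
open import Data.Integer using (+[1+_]; -[1+_]; _+_; _*_; _-_; -_)
open import Data.Integer.Divisibility.Signed as ℤ∣ using (divides; ∣⇒∣ᵤ; ∣m∣n⇒∣m-n; ∣n⇒∣m*n; ∣-refl)
import Data.Integer.Properties as ℤP
open import Data.Integer.Tactic.RingSolver using (solve-∀)
open import Data.List using (List; []; _∷_; map; filter; _++_; tabulate; allFin)
import Data.List.Properties as LP
open import Data.List.Relation.Unary.All as All using (All; []; _∷_)
open import Data.List.Relation.Unary.All.Properties using (all-filter)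
open import Data.Maybe using (Maybe; nothing)
open import Data.Nat as ℕ using (zero; suc; z≤n; s≤s)
open import Data.Nat.Combinatorics using (_C_; nC1≡n; nCk+nC[k+1]≡[n+1]C[k+1]; k>n⇒nCk≡0)
import Data.Nat.Divisibility as ℕ∣
open import Data.Nat.GeneralisedArithmetic using (fold)
open import Data.Nat.ListAction using (sum)
import Data.Nat.ListAction.Properties as SP
import Data.Nat.Properties as ℕP
open import Data.Sum using (inj₁; inj₂)
import Data.Vec as Vec
open import Data.Vec using ([]; _∷_; lookup)
import Data.Vec.Properties as VP
open import Function using (_∘_)
open import Relation.Binary.PropositionalEquality using (refl; trans; cong; cong₂; module ≡-Reasoning)
import Relation.Binary.PropositionalEquality as ≡
open import Relation.Nullary using (contradiction)
open import Relation.Nullary.Decidable using (Dec; does; dec-true; dec-false)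

bernstein : ℕ → (ℕ → ℤ) → ℤ → ℤ
bernstein zero    d q = d 0
bernstein (suc m) d q = q * bernstein m d q + d (suc m) * powℤ (+ 1 - q) (suc m)

bernstein-cong : ∀ m {d e : ℕ → ℤ} q → (∀ k → k ≤ m → d k ≡ e k) → bernstein m d q ≡ bernstein m e q
bernstein-cong zero    q d≗e = d≗e 0 z≤n
bernstein-cong (suc m) q d≗e = cong₂ (λ x y → q * x + y * powℤ (+ 1 - q) (suc m))
  (bernstein-cong m q (λ k k≤m → d≗e k (ℕP.m≤n⇒m≤1+n k≤m))) (d≗e (suc m) ℕP.≤-refl)

bernstein-zero : ∀ m q → bernstein m (λ _ → + 0) q ≡ + 0
bernstein-zero zero    q = refl
bernstein-zero (suc m) q = trans (ℤP.+-identityʳ _) (trans (cong (q *_) (bernstein-zero m q)) (ℤP.*-zeroʳ q))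

bernstein-add : ∀ m (d e : ℕ → ℤ) q → bernstein m (λ k → d k + e k) q ≡ bernstein m d q + bernstein m e q
bernstein-add zero    d e q = refl
bernstein-add (suc m) d e q =
  trans (cong (λ z → q * z + (d (suc m) + e (suc m)) * powℤ (+ 1 - q) (suc m)) (bernstein-add m d e q))
        (distrib q (bernstein m d q) (bernstein m e q) (d (suc m)) (e (suc m)) (powℤ (+ 1 - q) (suc m)))
  where
  distrib : ∀ q x y a b p → q * (x + y) + (a + b) * p ≡ (q * x + a * p) + (q * y + b * p)
  distrib = solve-∀

bernstein-sub : ∀ m (d e : ℕ → ℤ) q → bernstein m (λ k → d k - e k) q ≡ bernstein m d q - bernstein m e q
bernstein-sub zero    d e q = refl
bernstein-sub (suc m) d e q =
  trans (cong (λ z → q * z + (d (suc m) - e (suc m)) * powℤ (+ 1 - q) (suc m)) (bernstein-sub m d e q))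
        (distrib q (bernstein m d q) (bernstein m e q) (d (suc m)) (e (suc m)) (powℤ (+ 1 - q) (suc m)))
  where
  distrib : ∀ q x y a b p → q * (x - y) + (a - b) * p ≡ (q * x + a * p) - (q * y + b * p)
  distrib = solve-∀

bernstein-scale : ∀ m c (d : ℕ → ℤ) q → bernstein m (λ k → c * d k) q ≡ c * bernstein m d q
bernstein-scale zero    c d q = refl
bernstein-scale (suc m) c d q =
  trans (cong (λ z → q * z + c * d (suc m) * powℤ (+ 1 - q) (suc m)) (bernstein-scale m c d q))
        (distrib q c (bernstein m d q) (d (suc m)) (powℤ (+ 1 - q) (suc m)))
  where
  distrib : ∀ q c x a p → q * (c * x) + c * a * p ≡ c * (q * x + a * p)
  distrib = solve-∀

shift : (ℕ → ℤ) → ℕ → ℤ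
shift d zero    = + 0
shift d (suc k) = d k

bernstein-shift : ∀ m d q → bernstein (suc m) (shift d) q ≡ (+ 1 - q) * bernstein m d q
bernstein-shift zero    d q = factor q (d 0)
  where
  factor : ∀ q x → q * + 0 + x * ((+ 1 - q) * + 1) ≡ (+ 1 - q) * x
  factor = solve-∀
bernstein-shift (suc m) d q =
  trans (cong (λ z → q * z + d (suc m) * powℤ (+ 1 - q) (suc (suc m))) (bernstein-shift m d q))
        (factor q (+ 1 - q) (bernstein m d q) (d (suc m)) (powℤ (+ 1 - q) (suc m)))
  where
  factor : ∀ q u x a p → q * (u * x) + a * (u * p) ≡ u * (q * x + a * p)
  factor = solve-∀

binomial : ℕ → ℕ → ℤ
binomial m k = + (m C k)

binomial-pascal : ∀ m k → binomial (suc m) k ≡ binomial m k + shift (binomial m) k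
binomial-pascal m zero    = refl
binomial-pascal m (suc k) = begin
  + (suc m C suc k)         ≡⟨ cong +_ (≡.sym (nCk+nC[k+1]≡[n+1]C[k+1] m k)) ⟩
  + (m C k ℕ.+ m C suc k)   ≡⟨ cong +_ (ℕP.+-comm (m C k) (m C suc k)) ⟩
  + (m C suc k ℕ.+ m C k)   ≡⟨ ℤP.pos-+ (m C suc k) (m C k) ⟩
  + (m C suc k) + + (m C k) ∎
  where open ≡-Reasoning

bernstein-binomial : ∀ m q → bernstein m (binomial m) q ≡ + 1
bernstein-binomial zero    q = refl
bernstein-binomial (suc m) q = begin
  bernstein (suc m) (binomial (suc m)) q
    ≡⟨ bernstein-cong (suc m) q (λ k _ → binomial-pascal m k) ⟩
  bernstein (suc m) (λ k → binomial m k + shift (binomial m) k) q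
    ≡⟨ bernstein-add (suc m) (binomial m) (shift (binomial m)) q ⟩
  q * bernstein m (binomial m) q + binomial m (suc m) * p + bernstein (suc m) (shift (binomial m)) q
    ≡⟨ cong₂ (λ x y → q * x + + y * p + bernstein (suc m) (shift (binomial m)) q)
             (bernstein-binomial m q) (k>n⇒nCk≡0 (ℕP.n<1+n m)) ⟩
  q * + 1 + + 0 * p + bernstein (suc m) (shift (binomial m)) q
    ≡⟨ cong (λ z → q * + 1 + + 0 * p + z)
            (trans (bernstein-shift m (binomial m) q) (cong ((+ 1 - q) *_) (bernstein-binomial m q))) ⟩
  q * + 1 + + 0 * p + (+ 1 - q) * + 1
    ≡⟨ q+[1-q]≡1 q p ⟩
  + 1 ∎
  where
  open ≡-Reasoning
  p = powℤ (+ 1 - q) (suc m)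
  q+[1-q]≡1 : ∀ q p → q * + 1 + + 0 * p + (+ 1 - q) * + 1 ≡ + 1
  q+[1-q]≡1 = solve-∀

bernstein-power : ∀ j m q → bernstein (j ℕ.+ m) (fold (binomial m) shift j) q ≡ powℤ (+ 1 - q) j
bernstein-power zero    m q = bernstein-binomial m q
bernstein-power (suc j) m q =
  trans (bernstein-shift (j ℕ.+ m) (fold (binomial m) shift j) q) (cong ((+ 1 - q) *_) (bernstein-power j m q))

bernstein-indicator : ∀ s i v q → i ≤ s →
  bernstein s (λ k → if does (i ℕ.≟ k) then v else + 0) q ≡ v * (powℤ q (s ℕ.∸ i) * powℤ (+ 1 - q) i)
bernstein-indicator zero .zero v q z≤n = ≡.sym (ℤP.*-identityʳ v)
bernstein-indicator (suc s) i v q i≤1+s with ℕP.m≤n⇒m<n∨m≡n i≤1+s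
... | inj₁ (s≤s i≤s) = begin
  q * bernstein s δ q + δ (suc s) * p
    ≡⟨ cong₂ (λ x y → q * x + y * p) (bernstein-indicator s i v q i≤s)
             (cong (if_then v else + 0) (dec-false (i ℕ.≟ suc s) (ℕP.<⇒≢ (s≤s i≤s)))) ⟩
  q * (v * (powℤ q (s ℕ.∸ i) * u^i)) + + 0 * p
    ≡⟨ absorb-q q v (powℤ q (s ℕ.∸ i)) u^i p ⟩
  v * (powℤ q (suc (s ℕ.∸ i)) * u^i)
    ≡⟨ cong (λ e → v * (powℤ q e * u^i)) (ℕP.+-∸-assoc 1 i≤s) ⟨
  v * (powℤ q (suc s ℕ.∸ i) * u^i) ∎
  where
  open ≡-Reasoning
  δ = λ k → if does (i ℕ.≟ k) then v else + 0
  p = powℤ (+ 1 - q) (suc s)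
  u^i = powℤ (+ 1 - q) i
  absorb-q : ∀ q v x y p → q * (v * (x * y)) + + 0 * p ≡ v * ((q * x) * y)
  absorb-q = solve-∀
... | inj₂ refl = begin
  q * bernstein s δ q + δ (suc s) * p
    ≡⟨ cong₂ (λ x y → q * x + y * p) lower≡0 (cong (if_then v else + 0) (dec-true (suc s ℕ.≟ suc s) refl)) ⟩
  q * + 0 + v * p
    ≡⟨ top q v p ⟩
  v * (+ 1 * p)
    ≡⟨ cong (λ e → v * (powℤ q e * p)) (ℕP.n∸n≡0 s) ⟨
  v * (powℤ q (s ℕ.∸ s) * p) ∎
  where
  open ≡-Reasoning
  δ = λ k → if does (suc s ℕ.≟ k) then v else + 0
  p = powℤ (+ 1 - q) (suc s)
  δ≡0 : ∀ k → k ≤ s → δ k ≡ + 0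
  δ≡0 k k≤s = cong (if_then v else + 0) (dec-false (suc s ℕ.≟ k) (ℕP.<⇒≢ (s≤s k≤s) ∘ ≡.sym))
  lower≡0 : bernstein s δ q ≡ + 0
  lower≡0 = trans (bernstein-cong s q δ≡0) (bernstein-zero s q)
  top : ∀ q v p → q * + 0 + v * p ≡ v * (+ 1 * p)
  top = solve-∀

powℤ-1 : ∀ k → powℤ (+ 1) k ≡ + 1
powℤ-1 zero    = refl
powℤ-1 (suc k) = trans (ℤP.*-identityˡ _) (powℤ-1 k)

bernstein-at-0 : ∀ m d → bernstein m d (+ 0) ≡ d m
bernstein-at-0 zero    d = refl
bernstein-at-0 (suc m) d =
  trans (ℤP.+-identityˡ _) (trans (cong (d (suc m) *_) (powℤ-1 (suc m))) (ℤP.*-identityʳ (d (suc m))))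

q∣[1-q]^k-1 : ∀ q k → q ℤ∣.∣ powℤ (+ 1 - q) k - + 1
q∣[1-q]^k-1 q zero    = divides (+ 0) refl
q∣[1-q]^k-1 q (suc k) =
  ≡.subst (q ℤ∣.∣_) (expand q (powℤ (+ 1 - q) k)) (∣m∣n⇒∣m-n (∣n⇒∣m*n (+ 1 - q) (q∣[1-q]^k-1 q k)) ∣-refl)
  where
  expand : ∀ q p → (+ 1 - q) * (p - + 1) - q ≡ (+ 1 - q) * p - + 1
  expand = solve-∀

q∣bernstein[0]-bernstein[q] : ∀ m d q → q ℤ∣.∣ bernstein m d (+ 0) - bernstein m d q
q∣bernstein[0]-bernstein[q] zero    d q = ≡.subst (q ℤ∣.∣_) (≡.sym (ℤP.+-inverseʳ (d 0))) (divides (+ 0) refl)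
q∣bernstein[0]-bernstein[q] (suc m) d q =
  ≡.subst (q ℤ∣.∣_) (trans (regroup q (bernstein m d q) (d (suc m)) (powℤ (+ 1 - q) (suc m)))
                        (cong (_- bernstein (suc m) d q) (≡.sym (bernstein-at-0 (suc m) d))))
    (∣m∣n⇒∣m-n (∣n⇒∣m*n (- d (suc m)) (q∣[1-q]^k-1 q (suc m))) (∣n⇒∣m*n (bernstein m d q) ∣-refl))
  where
  regroup : ∀ q x a p → - a * (p - + 1) - x * q ≡ a - (q * x + a * p)
  regroup = solve-∀

1+∣i∣∣i⇒i≡0 : ∀ i → + suc ℤ.∣ i ∣ ℤ∣.∣ i → i ≡ + 0
1+∣i∣∣i⇒i≡0 i 1+∣i∣∣i = ℤP.∣i∣≡0⇒i≡0 (1+n∣n⇒n≡0 (∣⇒∣ᵤ 1+∣i∣∣i))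
  where
  1+n∣n⇒n≡0 : ∀ {n} → suc n ℕ∣.∣ n → n ≡ 0
  1+n∣n⇒n≡0 {zero}  _     = refl
  1+n∣n⇒n≡0 {suc n} 1+n∣n = contradiction 1+n∣n (ℕ∣.>⇒∤ ℕP.≤-refl)

-- bernstein m d 0 ≡ bernstein m d Q modulo Q; for Q = 1 + ∣ bernstein m d 0 ∣ this forces it to be 0.
bernstein-vanishes-at-0 : ∀ m d → (∀ q → .{{ℤ.NonZero q}} → bernstein m d q ≡ + 0) → bernstein m d (+ 0) ≡ + 0
bernstein-vanishes-at-0 m d vanishes = 1+∣i∣∣i⇒i≡0 x (≡.subst (Q ℤ∣.∣_) x-0≡x (q∣bernstein[0]-bernstein[q] m d Q))
  where
  x = bernstein m d (+ 0)
  Q = + suc ℤ.∣ x ∣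
  x-0≡x : x - bernstein m d Q ≡ x
  x-0≡x = trans (cong (λ y → x - y) (vanishes Q)) (ℤP.+-identityʳ x)

bernstein-succ≡0⇒bernstein≡0 : ∀ m d → (∀ q → bernstein (suc m) d q ≡ + 0) → ∀ q → bernstein m d q ≡ + 0
bernstein-succ≡0⇒bernstein≡0 m d B≡0 = vanishes
  where
  top≡0 : d (suc m) ≡ + 0
  top≡0 = trans (≡.sym (bernstein-at-0 (suc m) d)) (B≡0 (+ 0))
  q*B≡q*0 : ∀ q → q * bernstein m d q ≡ q * + 0
  q*B≡q*0 q = begin
    q * bernstein m d q                                 ≡⟨ ℤP.+-identityʳ _ ⟨
    q * bernstein m d q + + 0 * powℤ (+ 1 - q) (suc m)
      ≡⟨ cong (λ a → q * bernstein m d q + a * powℤ (+ 1 - q) (suc m)) top≡0 ⟨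
    bernstein (suc m) d q                               ≡⟨ B≡0 q ⟩
    + 0                                                 ≡⟨ ℤP.*-zeroʳ q ⟨
    q * + 0                                             ∎
    where open ≡-Reasoning
  vanishes-off-0 : ∀ q → .{{ℤ.NonZero q}} → bernstein m d q ≡ + 0
  vanishes-off-0 q = ℤP.*-cancelˡ-≡ q _ _ (q*B≡q*0 q)
  vanishes : ∀ q → bernstein m d q ≡ + 0
  vanishes (+ zero)      = bernstein-vanishes-at-0 m d vanishes-off-0
  vanishes q@(+[1+ _ ])  = vanishes-off-0 q
  vanishes q@(-[1+ _ ])  = vanishes-off-0 q

bernstein≡0⇒coefficients≡0 : ∀ m d → (∀ q → bernstein m d q ≡ + 0) → ∀ k → k ≤ m → d k ≡ + 0
bernstein≡0⇒coefficients≡0 m d B≡0 k k≤m with ℕP.m≤n⇒m<n∨m≡n k≤m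
... | inj₂ refl = trans (≡.sym (bernstein-at-0 m d)) (B≡0 (+ 0))
bernstein≡0⇒coefficients≡0 (suc m) d B≡0 k _ | inj₁ (s≤s k≤m) =
  bernstein≡0⇒coefficients≡0 m d (bernstein-succ≡0⇒bernstein≡0 m d B≡0) k k≤m

bernstein-injective : ∀ m d e → (∀ q → bernstein m d q ≡ bernstein m e q) → ∀ k → k ≤ m → d k ≡ e k
bernstein-injective m d e B≡B k k≤m = ℤP.i-j≡0⇒i≡j (d k) (e k)
  (bernstein≡0⇒coefficients≡0 m (λ k → d k - e k) (λ q → trans (bernstein-sub m d e q) (ℤP.i≡j⇒i-j≡0 (B≡B q))) k k≤m)

bernstein-quadratic-coefficients : ∀ m (f : ℕ → ℤ) α β γ →
  (∀ q → bernstein (2 ℕ.+ m) f q ≡ α + β * (+ 1 - q) + γ * ((+ 1 - q) * (+ 1 - q))) →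
  ∀ k → k ≤ 2 ℕ.+ m →
  f k ≡ α * binomial (2 ℕ.+ m) k + β * shift (binomial (1 ℕ.+ m)) k + γ * shift (shift (binomial m)) k
bernstein-quadratic-coefficients m f α β γ B≡quadratic =
  bernstein-injective (2 ℕ.+ m) f e (λ q → trans (B≡quadratic q) (≡.sym (B[e]≡quadratic q)))
  where
  e : ℕ → ℤ
  e k = α * binomial (2 ℕ.+ m) k + β * shift (binomial (1 ℕ.+ m)) k + γ * shift (shift (binomial m)) k
  B[e]≡quadratic : ∀ q → bernstein (2 ℕ.+ m) e q ≡ α + β * (+ 1 - q) + γ * ((+ 1 - q) * (+ 1 - q))
  B[e]≡quadratic q = begin
    bernstein (2 ℕ.+ m) e q
      ≡⟨ bernstein-add (2 ℕ.+ m) _ _ q ⟩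
    bernstein (2 ℕ.+ m) (λ k → α * binomial (2 ℕ.+ m) k + β * shift (binomial (1 ℕ.+ m)) k) q
      + bernstein (2 ℕ.+ m) (λ k → γ * shift (shift (binomial m)) k) q
      ≡⟨ cong (_+ bernstein (2 ℕ.+ m) (λ k → γ * shift (shift (binomial m)) k) q) (bernstein-add (2 ℕ.+ m) _ _ q) ⟩
    bernstein (2 ℕ.+ m) (λ k → α * binomial (2 ℕ.+ m) k) q
      + bernstein (2 ℕ.+ m) (λ k → β * shift (binomial (1 ℕ.+ m)) k) q
      + bernstein (2 ℕ.+ m) (λ k → γ * shift (shift (binomial m)) k) q
      ≡⟨ cong₂ _+_ (cong₂ _+_ (bernstein-scale (2 ℕ.+ m) α _ q) (bernstein-scale (2 ℕ.+ m) β _ q))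
                   (bernstein-scale (2 ℕ.+ m) γ _ q) ⟩
    α * bernstein (0 ℕ.+ (2 ℕ.+ m)) (binomial (2 ℕ.+ m)) q
      + β * bernstein (1 ℕ.+ (1 ℕ.+ m)) (shift (binomial (1 ℕ.+ m))) q
      + γ * bernstein (2 ℕ.+ m) (shift (shift (binomial m))) q
      ≡⟨ cong₂ _+_ (cong₂ (λ x y → α * x + β * y) (bernstein-power 0 (2 ℕ.+ m) q) (bernstein-power 1 (1 ℕ.+ m) q))
                   (cong (γ *_) (bernstein-power 2 m q)) ⟩
    α * + 1 + β * ((+ 1 - q) * + 1) + γ * ((+ 1 - q) * ((+ 1 - q) * + 1))
      ≡⟨ drop-units α β γ (+ 1 - q) ⟩
    α + β * (+ 1 - q) + γ * ((+ 1 - q) * (+ 1 - q)) ∎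
    where
    open ≡-Reasoning
    drop-units : ∀ α β γ u → α * + 1 + β * (u * + 1) + γ * (u * (u * + 1)) ≡ α + β * u + γ * (u * u)
    drop-units = solve-∀

binomℤ-negative : ∀ x n → binomℤ x -[1+ n ] ≡ + 0
binomℤ-negative (+ _)    n = refl
binomℤ-negative -[1+ _ ] n = refl

bernstein-quadratic-from-f₁-f₂ : ∀ s (f : ℕ → ℤ) a b c →
  (∀ q → bernstein s f q ≡ a * (q * q) - b * q + c) → f 0 ≡ + 0 →
  ∀ k → 1 ≤ k → k ≤ s →
  f k ≡ binomℤ (+ s - + 2) (+ k - + 2) * f 2
        + (binomℤ (+ s - + 1) (+ k - + 1) - (+ s - + 1) * binomℤ (+ s - + 2) (+ k - + 2)) * f 1
bernstein-quadratic-from-f₁-f₂ (suc s) f a b c _ _ 1 _ _ =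
  ≡.sym (trans (cong (λ z → z * f 2 + (+ 1 - (+ suc s - + 1) * z) * f 1) (binomℤ-negative (+ suc s - + 2) 0))
               (only-f1 (f 1) (f 2) (+ suc s - + 1)))
  where
  only-f1 : ∀ f₁ f₂ x → + 0 * f₂ + (+ 1 - x * + 0) * f₁ ≡ f₁
  only-f1 = solve-∀
bernstein-quadratic-from-f₁-f₂ (suc (suc m)) f a b c B≡quadratic f₀≡0 (suc (suc j)) _ 2+j≤2+m@(s≤s (s≤s _)) = begin
  f (2 ℕ.+ j)                                    ≡⟨ coefficient (2 ℕ.+ j) 2+j≤2+m ⟩
  β * Y + γ * Z                                  ≡⟨ regroup β γ Y Z (+ suc m) ⟩
  Z * (β * + suc m + γ) + (Y - + suc m * Z) * β  ≡⟨ cong₂ (λ x y → Z * x + (Y - + suc m * Z) * y) f₂≡ f₁≡ ⟨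
  Z * f 2 + (Y - + suc m * Z) * f 1              ∎
  where
  open ≡-Reasoning
  α = a - b + c
  β = b - + 2 * a
  γ = a
  Y = binomial (suc m) (suc j)
  Z = binomial m j
  re-expand : ∀ a b c q → a * (q * q) - b * q + c ≡ (a - b + c) + (b - + 2 * a) * (+ 1 - q) + a * ((+ 1 - q) * (+ 1 - q))
  re-expand = solve-∀
  coefficient-α : ∀ k → k ≤ 2 ℕ.+ m →
    f k ≡ α * binomial (2 ℕ.+ m) k + β * shift (binomial (1 ℕ.+ m)) k + γ * shift (shift (binomial m)) k
  coefficient-α = bernstein-quadratic-coefficients m f α β γ (λ q → trans (B≡quadratic q) (re-expand a b c q))
  α≡0 : α ≡ + 0
  α≡0 = trans (≡.sym (only-α α β γ)) (trans (≡.sym (coefficient-α 0 z≤n)) f₀≡0)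
    where
    only-α : ∀ α β γ → α * + 1 + β * + 0 + γ * + 0 ≡ α
    only-α = solve-∀
  coefficient : ∀ k → k ≤ 2 ℕ.+ m → f k ≡ β * shift (binomial (1 ℕ.+ m)) k + γ * shift (shift (binomial m)) k
  coefficient k k≤2+m = trans (coefficient-α k k≤2+m)
    (trans (cong (λ x → x * binomial (2 ℕ.+ m) k + β * Yₖ + γ * Zₖ) α≡0) (cong (_+ γ * Zₖ) (ℤP.+-identityˡ (β * Yₖ))))
    where
    Yₖ = shift (binomial (1 ℕ.+ m)) k
    Zₖ = shift (shift (binomial m)) k
  f₁≡ : f 1 ≡ β
  f₁≡ = trans (coefficient 1 (s≤s z≤n)) (β1+γ0≡β β γ)
    where
    β1+γ0≡β : ∀ β γ → β * + 1 + γ * + 0 ≡ β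
    β1+γ0≡β = solve-∀
  f₂≡ : f 2 ≡ β * + suc m + γ
  f₂≡ = trans (coefficient 2 (s≤s (s≤s z≤n))) (cong₂ (λ y z → β * + y + z) (nC1≡n (suc m)) (ℤP.*-identityʳ γ))
  regroup : ∀ β γ Y Z M → β * Y + γ * Z ≡ Z * (β * M + γ) + (Y - M * Z) * β
  regroup = solve-∀

bernstein-by-size : ∀ {A : Set} (size : A → ℕ) (g : A → ℤ) s q (xs : List A) → All (λ x → size x ≤ s) xs →
  bernstein s (λ k → sumℤ (map g (filter (λ x → size x ℕ.≟ k) xs))) q
    ≡ sumℤ (map (λ x → g x * (powℤ q (s ℕ.∸ size x) * powℤ (+ 1 - q) (size x))) xs)
bernstein-by-size size g s q []       []           = bernstein-zero s q
bernstein-by-size size g s q (x ∷ xs) (x≤s ∷ xs≤s) = begin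
  bernstein s (λ k → sumℤ (map g (filter (size-is? k) (x ∷ xs)))) q
    ≡⟨ bernstein-cong s q (λ k _ → filter-step k) ⟩
  bernstein s (λ k → (if does (size x ℕ.≟ k) then g x else + 0) + sumℤ (map g (filter (size-is? k) xs))) q
    ≡⟨ bernstein-add s _ _ q ⟩
  bernstein s (λ k → if does (size x ℕ.≟ k) then g x else + 0) q
    + bernstein s (λ k → sumℤ (map g (filter (size-is? k) xs))) q
    ≡⟨ cong₂ _+_ (bernstein-indicator s (size x) (g x) q x≤s) (bernstein-by-size size g s q xs xs≤s) ⟩
  sumℤ (map (λ x → g x * (powℤ q (s ℕ.∸ size x) * powℤ (+ 1 - q) (size x))) (x ∷ xs)) ∎
  where
  open ≡-Reasoning
  size-is? : ∀ k (x : _) → Dec (size x ≡ k)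
  size-is? k x = size x ℕ.≟ k
  filter-step : ∀ k → sumℤ (map g (filter (size-is? k) (x ∷ xs)))
                      ≡ (if does (size x ℕ.≟ k) then g x else + 0) + sumℤ (map g (filter (size-is? k) xs))
  filter-step k with does (size x ℕ.≟ k)
  ... | true  = refl
  ... | false = ≡.sym (ℤP.+-identityˡ _)

sumℤ-map-+ : ∀ ns → sumℤ (map +_ ns) ≡ + sum ns
sumℤ-map-+ []       = refl
sumℤ-map-+ (n ∷ ns) = trans (cong (_+_ (+ n)) (sumℤ-map-+ ns)) (≡.sym (ℤP.pos-+ n (sum ns)))

∣S─W∣+∣W∣≡∣S∣ : ∀ {m} (W S : Subset m) → subsetB W S ≡ true → ∣ S ─ W ∣ ℕ.+ ∣ W ∣ ≡ ∣ S ∣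
∣S─W∣+∣W∣≡∣S∣ []          []          refl = refl
∣S─W∣+∣W∣≡∣S∣ (false ∷ W) (false ∷ S) W⊆S  = ∣S─W∣+∣W∣≡∣S∣ W S W⊆S
∣S─W∣+∣W∣≡∣S∣ (false ∷ W) (true ∷ S)  W⊆S  = cong suc (∣S─W∣+∣W∣≡∣S∣ W S W⊆S)
∣S─W∣+∣W∣≡∣S∣ (true ∷ W)  (true ∷ S)  W⊆S  = trans (ℕP.+-suc _ _) (cong suc (∣S─W∣+∣W∣≡∣S∣ W S W⊆S))

calE≡bernstein : ∀ H S q → calE H S q ≡ bernstein ∣ S ∣ (λ k → + sumObsK H S k) q
calE≡bernstein H S q = begin
  calE H S q
    ≡⟨ cong sumℤ (LP.map-cong-local (All.map (λ {W} → cong (weight W) ∘ ∣S─W∣≡∣S∣∸∣W∣ W) subsets⊆S)) ⟩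
  sumℤ (map (λ W → weight W (s ℕ.∸ ∣ W ∣)) (subsetsOf S))
    ≡⟨ bernstein-by-size (λ W → ∣ W ∣) (λ W → + ∣ Obs H W ∣) s q (subsetsOf S)
                         (All.map (λ {W} → ∣W∣≤∣S∣ W) subsets⊆S) ⟨
  bernstein s (λ k → sumℤ (map (λ W → + ∣ Obs H W ∣) (subsetsOfSize S k))) q
    ≡⟨ bernstein-cong s q (λ k _ → sumℤ-subsetsOfSize k) ⟩
  bernstein s (λ k → + sumObsK H S k) q ∎
  where
  open ≡-Reasoning
  s = ∣ S ∣
  weight : Subset (n H) → ℕ → ℤ
  weight W e = + ∣ Obs H W ∣ * (powℤ q e * powℤ (+ 1 - q) ∣ W ∣)
  subsets⊆S : All (λ W → subsetB W S ≡ true) (subsetsOf S)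
  subsets⊆S = all-filter (λ W → subsetB W S Bool.≟ true) (allSubsets (n H))
  ∣S─W∣≡∣S∣∸∣W∣ : ∀ W → subsetB W S ≡ true → ∣ S ─ W ∣ ≡ ∣ S ∣ ℕ.∸ ∣ W ∣
  ∣S─W∣≡∣S∣∸∣W∣ W W⊆S =
    trans (≡.sym (ℕP.m+n∸n≡m ∣ S ─ W ∣ ∣ W ∣)) (cong (ℕ._∸ ∣ W ∣) (∣S─W∣+∣W∣≡∣S∣ W S W⊆S))
  ∣W∣≤∣S∣ : ∀ W → subsetB W S ≡ true → ∣ W ∣ ≤ ∣ S ∣
  ∣W∣≤∣S∣ W W⊆S = ≡.subst (∣ W ∣ ≤_) (∣S─W∣+∣W∣≡∣S∣ W S W⊆S) (ℕP.m≤n+m ∣ W ∣ ∣ S ─ W ∣)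
  sumℤ-subsetsOfSize : ∀ k → sumℤ (map (λ W → + ∣ Obs H W ∣) (subsetsOfSize S k)) ≡ + sumObsK H S k
  sumℤ-subsetsOfSize k =
    trans (cong sumℤ (LP.map-∘ (subsetsOfSize S k))) (sumℤ-map-+ (map (λ W → ∣ Obs H W ∣) (subsetsOfSize S k)))

sum-filter : ∀ {A : Set} {P : A → Set} (P? : ∀ x → Dec (P x)) (g : A → ℕ) xs →
  sum (map g (filter P? xs)) ≡ sum (map (λ x → if does (P? x) then g x else 0) xs)
sum-filter P? g []       = refl
sum-filter P? g (x ∷ xs) with does (P? x)
... | true  = cong (g x ℕ.+_) (sum-filter P? g xs)
... | false = sum-filter P? g xs

sum-map-≗0 : ∀ {A : Set} (g : A → ℕ) xs → (∀ x → g x ≡ 0) → sum (map g xs) ≡ 0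
sum-map-≗0 g []       g≗0 = refl
sum-map-≗0 g (x ∷ xs) g≗0 = cong₂ ℕ._+_ (g≗0 x) (sum-map-≗0 g xs g≗0)

sum-allSubsets-suc : ∀ m (h : Subset (suc m) → ℕ) → sum (map h (allSubsets (suc m)))
  ≡ sum (map (λ W → h (false ∷ W)) (allSubsets m)) ℕ.+ sum (map (λ W → h (true ∷ W)) (allSubsets m))
sum-allSubsets-suc m h = begin
  sum (map h (map (false ∷_) A ++ map (true ∷_) A))       ≡⟨ cong sum (LP.map-++ h (map (false ∷_) A) _) ⟩
  sum (map h (map (false ∷_) A) ++ map h (map (true ∷_) A)) ≡⟨ SP.sum-++ (map h (map (false ∷_) A)) _ ⟩
  sum (map h (map (false ∷_) A)) ℕ.+ sum (map h (map (true ∷_) A))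
    ≡⟨ cong₂ (λ xs ys → sum xs ℕ.+ sum ys) (LP.map-∘ A) (LP.map-∘ A) ⟨
  sum (map (λ W → h (false ∷ W)) A) ℕ.+ sum (map (λ W → h (true ∷ W)) A) ∎
  where
  open ≡-Reasoning
  A = allSubsets m

sizeRestricted : ∀ {m} → Subset m → ℕ → (Subset m → ℕ) → Subset m → ℕ
sizeRestricted S k g W = if does (subsetB W S Bool.≟ true) then (if does (∣ W ∣ ℕ.≟ k) then g W else 0) else 0

sum-subsetsOfSize : ∀ {m} (S : Subset m) k g →
  sum (map g (subsetsOfSize S k)) ≡ sum (map (sizeRestricted S k g) (allSubsets m))
sum-subsetsOfSize {m} S k g = trans (sum-filter (λ W → ∣ W ∣ ℕ.≟ k) g (subsetsOf S))
  (sum-filter (λ W → subsetB W S Bool.≟ true) (λ W → if does (∣ W ∣ ℕ.≟ k) then g W else 0) (allSubsets m))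

sum-sizeRestricted-0 : ∀ {m} (S : Subset m) g → sum (map (sizeRestricted S 0 g) (allSubsets m)) ≡ g ⊥
sum-sizeRestricted-0 []                g = ℕP.+-identityʳ (g [])
sum-sizeRestricted-0 {suc m} (s₀ ∷ S) g = begin
  sum (map (sizeRestricted (s₀ ∷ S) 0 g) (allSubsets (suc m)))
    ≡⟨ sum-allSubsets-suc m _ ⟩
  sum (map (sizeRestricted S 0 (g ∘ (false ∷_))) A) ℕ.+ sum (map (sizeRestricted (s₀ ∷ S) 0 g ∘ (true ∷_)) A)
    ≡⟨ cong₂ ℕ._+_ (sum-sizeRestricted-0 S (g ∘ (false ∷_)))
                   (sum-map-≗0 _ A (λ W → BoolP.if-eta (does ((s₀ ∧ subsetB W S) Bool.≟ true)))) ⟩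
  g ⊥ ℕ.+ 0
    ≡⟨ ℕP.+-identityʳ (g ⊥) ⟩
  g ⊥ ∎
  where
  open ≡-Reasoning
  A = allSubsets m

sum-sizeRestricted-1 : ∀ {m} (S : Subset m) g →
  sum (map (sizeRestricted S 1 g) (allSubsets m)) ≡ sum (tabulate (λ v → if lookup S v then g ⁅ v ⁆ else 0))
sum-sizeRestricted-1 []                g = refl
sum-sizeRestricted-1 {suc m} (s₀ ∷ S) g = begin
  sum (map (sizeRestricted (s₀ ∷ S) 1 g) (allSubsets (suc m)))
    ≡⟨ sum-allSubsets-suc m _ ⟩
  sum (map (sizeRestricted S 1 (g ∘ (false ∷_))) A) ℕ.+ sum (map (sizeRestricted (s₀ ∷ S) 1 g ∘ (true ∷_)) A)
    ≡⟨ cong₂ ℕ._+_ (sum-sizeRestricted-1 S (g ∘ (false ∷_))) (containing-0 s₀) ⟩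
  rest ℕ.+ (if s₀ then g ⁅ zero ⁆ else 0)
    ≡⟨ ℕP.+-comm rest (if s₀ then g ⁅ zero ⁆ else 0) ⟩
  (if s₀ then g ⁅ zero ⁆ else 0) ℕ.+ rest ∎
  where
  open ≡-Reasoning
  A = allSubsets m
  rest = sum (tabulate (λ v → if lookup S v then g (false ∷ ⁅ v ⁆) else 0))
  containing-0 : ∀ s₀ → sum (map (sizeRestricted (s₀ ∷ S) 1 g ∘ (true ∷_)) A) ≡ (if s₀ then g ⁅ zero ⁆ else 0)
  containing-0 false = sum-map-≗0 _ A (λ _ → refl)
  containing-0 true  = sum-sizeRestricted-0 S (g ∘ (true ∷_))

sumObs1≡sumObsK-1 : ∀ H S → sumObs1 H S ≡ sumObsK H S 1
sumObs1≡sumObsK-1 H S = begin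
  sum (map single (allFin (n H)))                      ≡⟨ cong sum (LP.map-tabulate (λ v → v) single) ⟩
  sum (tabulate single)                                ≡⟨ sum-sizeRestricted-1 S ∣Obs∣ ⟨
  sum (map (sizeRestricted S 1 ∣Obs∣) (allSubsets (n H))) ≡⟨ sum-subsetsOfSize S 1 ∣Obs∣ ⟨
  sumObsK H S 1                                        ∎
  where
  open ≡-Reasoning
  ∣Obs∣ : Subset (n H) → ℕ
  ∣Obs∣ W = ∣ Obs H W ∣
  single : Fin (n H) → ℕ
  single v = if mem v S then ∣ Obs H ⁅ v ⁆ ∣ else 0

-- The helpers of closedN and forced are where-bound in Defs and cannot be named from here;
-- each metavariable below is solved by unification against the unfolded definition, which
-- names the helper and lets us reason about it by induction on its list argument.
mutual
  closedN-search : (H : Graph) → Subset (n H) → List (Fin (n H)) → Fin (n H) → Bool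
  closedN-search H T = _

  closedN-unfold : ∀ H T → closedN H T ≡ Vec.tabulate (closedN-search H T (allFin (n H)))
  closedN-unfold H T with allFin (n H)
  ... | xs = refl

mutual
  forced-search : (H : Graph) → Subset (n H) → List (Fin (n H)) → Maybe (Fin (n H))
  forced-search H B = _

  forced-unfold : ∀ H B → forced H B ≡ forced-search H B (allFin (n H))
  forced-unfold H B with allFin (n H)
  ... | xs = refl

closedN-⊥ : ∀ H → closedN H ⊥ ≡ ⊥
closedN-⊥ H = begin
  closedN H ⊥                                           ≡⟨ closedN-unfold H ⊥ ⟩
  Vec.tabulate (closedN-search H ⊥ (allFin (n H)))
    ≡⟨ VP.tabulate-cong (λ y → trans (search-⊥ (allFin (n H)) y) (≡.sym (VP.lookup-replicate y false))) ⟩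
  Vec.tabulate (lookup ⊥)                               ≡⟨ VP.tabulate∘lookup ⊥ ⟩
  ⊥                                                     ∎
  where
  open ≡-Reasoning
  search-⊥ : ∀ xs y → closedN-search H ⊥ xs y ≡ false
  search-⊥ []       y = refl
  search-⊥ (x ∷ xs) y rewrite VP.lookup-replicate x false = search-⊥ xs y

forced-⊥ : ∀ H → forced H ⊥ ≡ nothing
forced-⊥ H = trans (forced-unfold H ⊥) (search-⊥ (allFin (n H)))
  where
  search-⊥ : ∀ xs → forced-search H ⊥ xs ≡ nothing
  search-⊥ []       = refl
  search-⊥ (x ∷ xs) rewrite VP.lookup-replicate x false = search-⊥ xs

propagate-stuck : ∀ H f B → forced H B ≡ nothing → propagate H f B ≡ B
propagate-stuck H zero    B _     = refl
propagate-stuck H (suc f) B stuck rewrite stuck = refl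

∣Obs-⊥∣≡0 : ∀ H → ∣ Obs H ⊥ ∣ ≡ 0
∣Obs-⊥∣≡0 H = begin
  ∣ propagate H (n H) (closedN H ⊥) ∣ ≡⟨ cong (λ B → ∣ propagate H (n H) B ∣) (closedN-⊥ H) ⟩
  ∣ propagate H (n H) ⊥ ∣             ≡⟨ cong ∣_∣ (propagate-stuck H (n H) ⊥ (forced-⊥ H)) ⟩
  ∣ ⊥ {n = n H} ∣                     ≡⟨ SubP.∣⊥∣≡0 (n H) ⟩
  0                                   ∎
  where open ≡-Reasoning

sumObsK-0 : ∀ H S → sumObsK H S 0 ≡ 0
sumObsK-0 H S = trans (sum-subsetsOfSize S 0 (λ W → ∣ Obs H W ∣))
                      (trans (sum-sizeRestricted-0 S (λ W → ∣ Obs H W ∣)) (∣Obs-⊥∣≡0 H))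

theorem3p7 : (s : ℕ) (a b c : ℤ) (G : Graph) (S : Subset (n G)) →
    ∣ S ∣ ≡ s →
    (+ s ℤ.+ + 2 ℤ.* a ℤ.+ + 16) ℤ.≤ b →
    (+ s ℤ.+ + 6) ℤ.≤ b →
    (∀ (q : ℤ) → calE G S q ≡ a ℤ.* (q ℤ.* q) ℤ.- b ℤ.* q ℤ.+ c) →
    ∀ (k : ℕ) → 1 ≤ k → k ≤ s →
    + sumObsK G S k ≡
      binomℤ (+ s ℤ.- + 2) (+ k ℤ.- + 2) ℤ.* + sumObsK G S 2
      ℤ.+ (binomℤ (+ s ℤ.- + 1) (+ k ℤ.- + 1)
           ℤ.- (+ s ℤ.- + 1) ℤ.* binomℤ (+ s ℤ.- + 2) (+ k ℤ.- + 2))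
          ℤ.* + sumObs1 G S
theorem3p7 s a b c G S refl _ _ calE≡quadratic k 1≤k k≤s = begin
  + sumObsK G S k
    ≡⟨ bernstein-quadratic-from-f₁-f₂ s (λ k → + sumObsK G S k) a b c
         (λ q → trans (≡.sym (calE≡bernstein G S q)) (calE≡quadratic q)) (cong +_ (sumObsK-0 G S)) k 1≤k k≤s ⟩
  Z * + sumObsK G S 2 + (Y - (+ s - + 1) * Z) * + sumObsK G S 1
    ≡⟨ cong (λ x → Z * + sumObsK G S 2 + (Y - (+ s - + 1) * Z) * + x) (sumObs1≡sumObsK-1 G S) ⟨
  Z * + sumObsK G S 2 + (Y - (+ s - + 1) * Z) * + sumObs1 G S ∎
  where
  open ≡-Reasoning
  Y = binomℤ (+ s - + 1) (+ k - + 1)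
  Z = binomℤ (+ s - + 2) (+ k - + 2)
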